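{- Let $Z\in\{H,V\}^k$ contain $h$ occurrences of $H$ and $v$ occurrences of $V$, and let $B_1,B_2$ be diagonally connected $Z$-blocks. Then for each pair $(x,y)\in\{(B_1^+,B_2^+),(B_1^-,B_2^-)\}$ there exists a $Z$-path $P=(P(0),\dots,P(k))$ with $P(0)=x$ and $P(k)=y$.
   Context: Write $H=(1,0)$, $V=(0,1)$ in $\mathbb{Z}^2$ (the second coordinate increases downward), and for $Z=Z(1)\cdots Z(k)$ identify each letter with the corresponding vector. A $Z$-block subdivision is a partition of $\mathbb{Z}^2$ into the rectangles ($Z$-blocks) $a+(ih,jv)+\{0,\dots,h-1\}\times\{0,\dots,v-1\}$, $i,j\in\mathbb{Z}$, for a fixed $a\in\mathbb{Z}^2$. For a block $B$, its positive source cell $B^+$ is its upper-left cell $a+(ih,jv)$ and its negative source cell is its lower-left cell $B^-=B^++(0,v-1)$. Two blocks $B_1,B_2$ are diagonally connected if there is a block horizontally adjacent (immediately left or right) to $B_1$ and vertically adjacent (immediately above or below) to $B_2$, i.e. $B_2^+=B_1^++(\sigma h,\tau v)$ for some $\sigma,\tau\in\{ -1,1\}$. A $Z$-path is a sequence $P=(P(0),\dots,P(l))$ of cells, $l\le k$, for which there exist $\alpha,\beta\in\{ -1,1\}$ such that for every $1\le s\le l$: $P(s)=P(s-1)+\alpha H$ if $Z(s)=H$, and $P(s)=P(s-1)+\beta V$ if $Z(s)=V$. -}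

module Defs where

open import Data.Nat as ℕ using (ℕ; zero; suc)
open import Data.Integer as ℤ using (ℤ; +_; -[1+_])
open import Data.Fin using (Fin; zero; suc; toℕ; inject₁)
open import Data.Vec using (Vec; lookup; count)
open import Data.Product using (_×_; _,_; Σ; ∃; ∃-syntax)
open import Data.Sum using (_⊎_)
open import Relation.Binary.PropositionalEquality using (_≡_; _≢_)
open import Relation.Nullary using (Dec; yes; no)

data Letter : Set where
  H V : Letter

_≟L_ : (x y : Letter) → Dec (x ≡ y)
H ≟L H = yes _≡_.refl
H ≟L V = no (λ ())
V ≟L H = no (λ ())
V ≟L V = yes _≡_.refl

-- A word Z = Z(1)...Z(k) of length k; Z(s) is  lookup Z (s-1)
Word : ℕ → Set
Word k = Vec Letter k

#H : ∀ {k} → Word k → ℕ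
#H Z = count (_≟L H) Z

#V : ∀ {k} → Word k → ℕ
#V Z = count (_≟L V) Z

-- Cells of ℤ² (second coordinate increases downward)
Cell : Set
Cell = ℤ × ℤ

_⊕_ : Cell → Cell → Cell
(a , b) ⊕ (c , d) = (a ℤ.+ c , b ℤ.+ d)

infixl 6 _⊕_

_·_ : ℤ → Cell → Cell
n · (a , b) = (n ℤ.* a , n ℤ.* b)

infixl 7 _·_

HV : Cell
HV = (+ 1 , + 0)

VV : Cell
VV = (+ 0 , + 1)

vec : Letter → Cell
vec H = HV
vec V = VV

data Sign : Set where
  plus minus : Sign

⟦_⟧ : Sign → ℤ
⟦ plus ⟧ = + 1
⟦ minus ⟧ = -[1+ 0 ]

-- A Z-block subdivision with anchor a (block widths h = #H Z, heights v = #V Z).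
-- A Z-block of it is indexed by (i , j) ∈ ℤ²; it is the rectangle
--   a + (i h , j v) + {0..h-1} × {0..v-1}.
Block : Set
Block = ℤ × ℤ

module _ {k : ℕ} (Z : Word k) (a : Cell) where

  hZ vZ : ℤ
  hZ = + #H Z
  vZ = + #V Z

  _∈Block_ : Cell → Block → Set
  c ∈Block (i , j) =
    ∃[ x ] ∃[ y ] (x ℕ.< #H Z × y ℕ.< #V Z ×
      c ≡ a ⊕ (i ℤ.* hZ , j ℤ.* vZ) ⊕ (+ x , + y))

  src⁺ : Block → Cell
  src⁺ (i , j) = a ⊕ (i ℤ.* hZ , j ℤ.* vZ)

  src⁻ : Block → Cell
  src⁻ B = src⁺ B ⊕ (+ 0 , vZ ℤ.- + 1)

  DiagConn : Block → Block → Set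
  DiagConn B₁ B₂ =
    ∃[ σ ] ∃[ τ ] (src⁺ B₂ ≡ src⁺ B₁ ⊕ (⟦ σ ⟧ ℤ.* hZ , ⟦ τ ⟧ ℤ.* vZ))

step : Sign → Sign → Letter → Cell
step α β H = ⟦ α ⟧ · HV
step α β V = ⟦ β ⟧ · VV

IsZPath : ∀ {k} → Word k → (l : ℕ) → l ℕ.≤ k → (Fin (suc l) → Cell) → Set
IsZPath {k} Z l l≤k P =
  ∃[ α ] ∃[ β ] ((s : Fin l) →
    P (suc s) ≡ P (inject₁ s) ⊕ step α β (lookup Z (Data.Fin.inject≤ s l≤k)))

{-# OPTIONS --safe #-}
-- A Z-path with signs α, β moves by α in x for each H and by β in y for each V,
-- so whatever its signs, its endpoints differ by (± h , ± v); a diagonal neighbour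
-- of a block sits at exactly such an offset, for both source cells alike.
module Submission where

open import Defs
open import Data.Nat using (ℕ; suc)
open import Data.Nat.Properties using (≤-refl)
open import Data.Fin using (Fin; zero; suc; fromℕ; inject₁; inject≤)
open import Data.Vec using ([]; _∷_; lookup)
open import Data.Product using (_×_; _,_; ∃-syntax)
open import Data.Sum using (_⊎_; inj₁; inj₂)
open import Data.Integer as ℤ using (+_)
import Data.Integer.Properties as ℤ
open import Relation.Binary.PropositionalEquality

⊕-assoc : (p q r : Cell) → (p ⊕ q) ⊕ r ≡ p ⊕ (q ⊕ r)
⊕-assoc (p₁ , p₂) (q₁ , q₂) (r₁ , r₂) = cong₂ _,_ (ℤ.+-assoc p₁ q₁ r₁) (ℤ.+-assoc p₂ q₂ r₂)

⊕-comm : (p q : Cell) → p ⊕ q ≡ q ⊕ p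
⊕-comm (p₁ , p₂) (q₁ , q₂) = cong₂ _,_ (ℤ.+-comm p₁ q₁) (ℤ.+-comm p₂ q₂)

⊕-swapʳ : (p q r : Cell) → (p ⊕ q) ⊕ r ≡ (p ⊕ r) ⊕ q
⊕-swapʳ p q r = begin
  (p ⊕ q) ⊕ r  ≡⟨ ⊕-assoc p q r ⟩
  p ⊕ (q ⊕ r)  ≡⟨ cong (p ⊕_) (⊕-comm q r) ⟩
  p ⊕ (r ⊕ q)  ≡⟨ ⊕-assoc p r q ⟨
  (p ⊕ r) ⊕ q  ∎
  where open ≡-Reasoning

displacement : ∀ {k} → Sign → Sign → Word k → Cell
displacement α β Z = (⟦ α ⟧ ℤ.* + #H Z , ⟦ β ⟧ ℤ.* + #V Z)

step-⊕-displacement : ∀ {k} α β c (Z : Word k) →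
  step α β c ⊕ displacement α β Z ≡ displacement α β (c ∷ Z)
step-⊕-displacement α β H Z = cong₂ _,_
  (sym (ℤ.*-distribˡ-+ ⟦ α ⟧ (+ 1) (+ #H Z)))
  (trans (cong (ℤ._+ ⟦ β ⟧ ℤ.* + #V Z) (ℤ.*-zeroʳ ⟦ α ⟧)) (ℤ.+-identityˡ _))
step-⊕-displacement α β V Z = cong₂ _,_
  (trans (cong (ℤ._+ ⟦ α ⟧ ℤ.* + #H Z) (ℤ.*-zeroʳ ⟦ β ⟧)) (ℤ.+-identityˡ _))
  (sym (ℤ.*-distribˡ-+ ⟦ β ⟧ (+ 1) (+ #V Z)))

walk : ∀ {k} → Word k → Sign → Sign → Cell → Fin (suc k) → Cell
walk Z       α β x zero    = x
walk (c ∷ Z) α β x (suc s) = walk Z α β (x ⊕ step α β c) s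

walk-isZPath : ∀ {k} (Z : Word k) α β x → IsZPath Z k ≤-refl (walk Z α β x)
walk-isZPath Z α β x = α , β , walk-step Z x
  where
  walk-step : ∀ {k} (Z : Word k) x (s : Fin k) →
    walk Z α β x (suc s) ≡ walk Z α β x (inject₁ s) ⊕ step α β (lookup Z (inject≤ s ≤-refl))
  walk-step (c ∷ Z) x zero    = refl
  walk-step (c ∷ Z) x (suc s) = walk-step Z (x ⊕ step α β c) s

walk-last : ∀ {k} (Z : Word k) α β x → walk Z α β x (fromℕ k) ≡ x ⊕ displacement α β Z
walk-last []      α β (x₁ , x₂) = sym (cong₂ _,_
  (trans (cong (λ z → x₁ ℤ.+ z) (ℤ.*-zeroʳ ⟦ α ⟧)) (ℤ.+-identityʳ x₁))
  (trans (cong (λ z → x₂ ℤ.+ z) (ℤ.*-zeroʳ ⟦ β ⟧)) (ℤ.+-identityʳ x₂)))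
walk-last (c ∷ Z) α β x = begin
  walk Z α β (x ⊕ step α β c) (fromℕ _)       ≡⟨ walk-last Z α β (x ⊕ step α β c) ⟩
  (x ⊕ step α β c) ⊕ displacement α β Z       ≡⟨ ⊕-assoc x _ _ ⟩
  x ⊕ (step α β c ⊕ displacement α β Z)       ≡⟨ cong (x ⊕_) (step-⊕-displacement α β c Z) ⟩
  x ⊕ displacement α β (c ∷ Z)                ∎
  where open ≡-Reasoning

src⁻-translate : ∀ {k} (Z : Word k) a B₁ B₂ d →
  src⁺ Z a B₂ ≡ src⁺ Z a B₁ ⊕ d → src⁻ Z a B₂ ≡ src⁻ Z a B₁ ⊕ d
src⁻-translate Z a B₁ B₂ d eq =
  trans (cong (_⊕ (+ 0 , vZ Z a ℤ.- + 1)) eq) (⊕-swapʳ (src⁺ Z a B₁) d _)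

lemma1 : (k : ℕ) (Z : Word k) (a : Cell) (B₁ B₂ : Block) →
    DiagConn Z a B₁ B₂ →
    (x y : Cell) →
    ((x ≡ src⁺ Z a B₁ × y ≡ src⁺ Z a B₂) ⊎ (x ≡ src⁻ Z a B₁ × y ≡ src⁻ Z a B₂)) →
    ∃[ P ] (IsZPath Z k ≤-refl P × P zero ≡ x × P (fromℕ k) ≡ y)
lemma1 k Z a B₁ B₂ (σ , τ , diag) x y sources =
  walk Z σ τ x , walk-isZPath Z σ τ x , refl ,
  trans (walk-last Z σ τ x) (sym (target-offset sources))
  where
  target-offset : (x ≡ src⁺ Z a B₁ × y ≡ src⁺ Z a B₂) ⊎ (x ≡ src⁻ Z a B₁ × y ≡ src⁻ Z a B₂) →
    y ≡ x ⊕ displacement σ τ Z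
  target-offset (inj₁ (refl , refl)) = diag
  target-offset (inj₂ (refl , refl)) = src⁻-translate Z a B₁ B₂ _ diag
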